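{- Let $f\ge 3$ and let $(v,k,m,n,\lambda_1,\lambda_2)$ be the parameters of a linked system of $f$ proper symmetric group divisible designs. If $\lambda_1=0$, then $(v,k,m,n,\lambda_1,\lambda_2)=(n^3l^2,n^2l^2,n^2l^2,n,0,nl^2)$ for some positive integer $l$.
   Context: $I_n,J_n$ denote the identity and all-ones matrices of order $n$, and $\otimes$ is the Kronecker product. For integers $m,n\ge 2$ and $v=mn$, a $v\times v$ $(0,1)$-matrix $A$ is the incidence matrix of a symmetric group divisible design with parameters $(v,k,m,n,\lambda_1,\lambda_2)$ (with $0<k<v$) if $AA^\top=A^\top A=kI_v+\lambda_1(I_m\otimes J_n-I_v)+\lambda_2(J_v-I_m\otimes J_n)$; it is proper if $\lambda_1\neq\lambda_2$. A linked system of $f$ symmetric group divisible designs with parameters $(v,k,m,n,\lambda_1,\lambda_2)$ is a family of $v\times v$ $(0,1)$-matrices $A_{i,j}$ ($i,j\in\{1,\ldots,f\}$, $i\ne j$) with $A_{i,j}^\top=A_{j,i}$, each the incidence matrix of a symmetric group divisible design with these parameters, such that there are integers $\sigma,\tau$ with $A_{i,j}A_{j,l}=\sigma A_{i,l}+\tau(J_v-A_{i,l})$ for all pairwise distinct $i,j,l$. -}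

module Defs where

open import Data.Nat as ℕ using (ℕ; _/_; _≥_; _<_; NonZero)
open import Data.Integer as ℤ using (ℤ; +_; 0ℤ; 1ℤ)
open import Data.Fin using (Fin; toℕ) renaming (zero to fzero; suc to fsuc)
open import Data.Fin.Properties using (_≟_)
open import Data.Nat.Properties using () renaming (_≟_ to _≟ℕ_)
open import Data.Product using (_×_; Σ)
open import Data.Sum using (_⊎_)
open import Relation.Binary.PropositionalEquality using (_≡_; _≢_)
open import Relation.Nullary using (does)
open import Data.Bool using (if_then_else_)

Mat : ℕ → Set
Mat v = Fin v → Fin v → ℤ

Σᶠ : (v : ℕ) → (Fin v → ℤ) → ℤ
Σᶠ ℕ.zero    g = 0ℤ
Σᶠ (ℕ.suc v) g = g fzero ℤ.+ Σᶠ v (λ x → g (fsuc x))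

_·_ : {v : ℕ} → Mat v → Mat v → Mat v
_·_ {v} A B x y = Σᶠ v (λ z → A x z ℤ.* B z y)

transpose : {v : ℕ} → Mat v → Mat v
transpose A x y = A y x

IsZeroOne : {v : ℕ} → Mat v → Set
IsZeroOne A = ∀ x y → (A x y ≡ 0ℤ) ⊎ (A x y ≡ 1ℤ)

Iₘ : (v : ℕ) → Mat v
Iₘ v x y = if does (x ≟ y) then 1ℤ else 0ℤ

Jₘ : (v : ℕ) → Mat v
Jₘ v x y = 1ℤ

-- I_m ⊗ J_n, indexed by Fin (m * n): row x = a*n + b lies in block a = x / n
IkronJ : (m n : ℕ) → .{{_ : NonZero n}} → Mat (m ℕ.* n)
IkronJ m n x y = if does ((toℕ x / n) ≟ℕ (toℕ y / n)) then 1ℤ else 0ℤ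

_+ₘ_ : {v : ℕ} → Mat v → Mat v → Mat v
(A +ₘ B) x y = A x y ℤ.+ B x y

_-ₘ_ : {v : ℕ} → Mat v → Mat v → Mat v
(A -ₘ B) x y = A x y ℤ.- B x y

_⋆_ : {v : ℕ} → ℤ → Mat v → Mat v
(c ⋆ A) x y = c ℤ.* A x y

IsSGDD : (k m n λ₁ λ₂ : ℕ) → .{{_ : NonZero n}} → Mat (m ℕ.* n) → Set
IsSGDD k m n λ₁ λ₂ A =
  IsZeroOne A × 0 < k × k < v ×
  (∀ x y → (A · transpose A) x y ≡ G x y) ×
  (∀ x y → (transpose A · A) x y ≡ G x y)
  where
  v = m ℕ.* n
  G : Mat v
  G = ((+ k) ⋆ Iₘ v)
      +ₘ (((+ λ₁) ⋆ (IkronJ m n -ₘ Iₘ v))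
      +ₘ ((+ λ₂) ⋆ (Jₘ v -ₘ IkronJ m n)))

IsLinkedSystem : (f k m n λ₁ λ₂ : ℕ) → .{{_ : NonZero n}} →
  (Fin f → Fin f → Mat (m ℕ.* n)) → Set
IsLinkedSystem f k m n λ₁ λ₂ A =
  (∀ i j → i ≢ j → ∀ x y → transpose (A i j) x y ≡ A j i x y) ×
  (∀ i j → i ≢ j → IsSGDD k m n λ₁ λ₂ (A i j)) ×
  Σ ℤ (λ σ → Σ ℤ (λ τ →
    ∀ i j l → i ≢ j → j ≢ l → i ≢ l → ∀ x y →
      (A i j · A j l) x y ≡ ((σ ⋆ A i l) +ₘ (τ ⋆ (Jₘ _ -ₘ A i l))) x y))

module Submission where

-- With λ₁ = 0 the Gram matrix of each design is G = k I + λ₂ (J − K), where K = I_m ⊗ J_n.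
-- Fix three indices a, b, c, write B = A_bc and s = σ − τ, and expand A_ba A_ab A_bc in two
-- ways: through the linking law it is s (σ B + τ (J − B)) + τ k J, through A_ba A_ab = G it
-- is k B + λ₂ k J − λ₂ K B.  Hence (k − s²) B = λ₂ K B + (constant) J.  Two points of one
-- group have equal rows in K B, so if k ≠ s² they would have equal rows in B, forcing
-- k = λ₁ = 0.  Thus k = s², λ₂ K B is constant, and comparing K B Bᵀ = K G on the diagonal
-- gives λ₂ = λ₂ k − s τ − τ k.  Together with the row sums k² = s k + τ v and
-- k² = k + λ₂ (v − n) of A_ab A_bc and A_ab A_ba, elementary algebra yields m = k = (n l)²
-- and λ₂ = n l² with l = |λ₂ − τ|.

import Data.Nat.Base as ℕ
open import Data.Nat.Base using (ℕ; NonZero)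
open import Data.Fin.Base using (Fin) renaming (zero to fzero; suc to fsuc)
open import Data.Product.Base using (_×_; Σ; _,_; proj₁; proj₂)
open import Relation.Binary.PropositionalEquality using (_≡_; _≢_; refl; sym)

open import Defs

module Integers where

  open import Data.Integer.Base using (ℤ; 0ℤ; _+_; _*_; _-_; ≢-nonZero)
  import Data.Integer.Properties as ℤ
  open import Data.Integer.Tactic.RingSolver using (solve)
  open import Data.List.Base using ([]; _∷_)
  open import Relation.Binary.PropositionalEquality using (cong; trans; module ≡-Reasoning)
  open ≡-Reasoning

  same-difference : ∀ {x y z w : ℤ} → x ≡ y → z - w ≡ x - y → z ≡ w
  same-difference {x} {y} {z} {w} x≡y z-w≡x-y =
    ℤ.i-j≡0⇒i≡j z w (trans z-w≡x-y (ℤ.i≡j⇒i-j≡0 x≡y))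

  isolateˡ : ∀ {x y z : ℤ} → x + y ≡ z → x ≡ z - y
  isolateˡ {x} {y} {z} x+y≡z = begin
    x          ≡⟨ solve (x ∷ y ∷ []) ⟩
    x + y - y  ≡⟨ cong (_- y) x+y≡z ⟩
    z - y      ∎

  isolateʳ : ∀ {x y z : ℤ} → x ≡ y + z → z ≡ x - y
  isolateʳ {x} {y} {z} x≡y+z = begin
    z          ≡⟨ solve (y ∷ z ∷ []) ⟩
    y + z - y  ≡⟨ cong (_- y) x≡y+z ⟨
    x - y      ∎

  cancelˡ : ∀ {i j k : ℤ} → i ≢ 0ℤ → i * j ≡ i * k → j ≡ k
  cancelˡ {i} {j} {k} i≢0 = ℤ.*-cancelˡ-≡ i j k {{≢-nonZero i≢0}}

  cancelʳ : ∀ {i j k : ℤ} → k ≢ 0ℤ → i * k ≡ j * k → i ≡ j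
  cancelʳ {i} {j} {k} k≢0 = ℤ.*-cancelʳ-≡ i j k {{≢-nonZero k≢0}}

module Matrices where

  import Data.Integer.Properties as ℤ
  open import Algebra.Properties.Semiring.Sum ℤ.+-*-semiring
    using (sum; sum-cong-≗; sum-replicate-zero; ∑-distrib-+; ∑-comm; *-distribˡ-sum; *-distribʳ-sum)
  open import Data.Bool.Base using (if_then_else_)
  open import Data.Fin.Base using (toℕ)
  open import Data.Fin.Properties using (_≟_)
  open import Data.Integer.Base using (ℤ; +_; 0ℤ; 1ℤ; -1ℤ; _+_; _*_; _-_; -_)
  open import Data.Integer.Tactic.RingSolver using (solve-∀)
  open import Data.Nat.Base using (_/_; _≤_; zero; suc; s≤s)
  open import Data.Nat.DivMod using (m<n⇒m/n≡0; m≥n⇒m/n>0)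
  import Data.Nat.Properties as ℕ
  open import Data.Sum.Base using (_⊎_; inj₁; inj₂)
  open import Relation.Binary.PropositionalEquality using (cong; cong₂; trans; module ≡-Reasoning)
  open import Relation.Nullary using (¬_; does; yes; no)
  open import Relation.Nullary.Decidable using (dec-true; dec-false)
  open ≡-Reasoning

  Σᶠ≡sum : ∀ v (g : Fin v → ℤ) → Σᶠ v g ≡ sum g
  Σᶠ≡sum zero    g = refl
  Σᶠ≡sum (suc v) g = cong (_+_ (g fzero)) (Σᶠ≡sum v (λ z → g (fsuc z)))

  Σᶠ-cong : ∀ v {g h : Fin v → ℤ} → (∀ z → g z ≡ h z) → Σᶠ v g ≡ Σᶠ v h
  Σᶠ-cong v {g} {h} g≗h = begin
    Σᶠ v g  ≡⟨ Σᶠ≡sum v g ⟩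
    sum g   ≡⟨ sum-cong-≗ g≗h ⟩
    sum h   ≡⟨ Σᶠ≡sum v h ⟨
    Σᶠ v h  ∎

  Σᶠ-zero : ∀ v → Σᶠ v (λ _ → 0ℤ) ≡ 0ℤ
  Σᶠ-zero v = trans (Σᶠ≡sum v _) (sum-replicate-zero v)

  Σᶠ-one : ∀ v → Σᶠ v (λ _ → 1ℤ) ≡ + v
  Σᶠ-one zero    = refl
  Σᶠ-one (suc v) = cong (_+_ 1ℤ) (Σᶠ-one v)

  Σᶠ-distrib-+ : ∀ v (g h : Fin v → ℤ) → Σᶠ v (λ z → g z + h z) ≡ Σᶠ v g + Σᶠ v h
  Σᶠ-distrib-+ v g h = begin
    Σᶠ v (λ z → g z + h z)  ≡⟨ Σᶠ≡sum v _ ⟩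
    sum (λ z → g z + h z)   ≡⟨ ∑-distrib-+ g h ⟩
    sum g + sum h           ≡⟨ cong₂ _+_ (Σᶠ≡sum v g) (Σᶠ≡sum v h) ⟨
    Σᶠ v g + Σᶠ v h         ∎

  *-distribˡ-Σᶠ : ∀ v p (g : Fin v → ℤ) → p * Σᶠ v g ≡ Σᶠ v (λ z → p * g z)
  *-distribˡ-Σᶠ v p g = begin
    p * Σᶠ v g             ≡⟨ cong (p *_) (Σᶠ≡sum v g) ⟩
    p * sum g              ≡⟨ *-distribˡ-sum p g ⟩
    sum (λ z → p * g z)    ≡⟨ Σᶠ≡sum v _ ⟨
    Σᶠ v (λ z → p * g z)   ∎

  *-distribʳ-Σᶠ : ∀ v p (g : Fin v → ℤ) → Σᶠ v g * p ≡ Σᶠ v (λ z → g z * p)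
  *-distribʳ-Σᶠ v p g = begin
    Σᶠ v g * p             ≡⟨ cong (_* p) (Σᶠ≡sum v g) ⟩
    sum g * p              ≡⟨ *-distribʳ-sum p g ⟩
    sum (λ z → g z * p)    ≡⟨ Σᶠ≡sum v _ ⟨
    Σᶠ v (λ z → g z * p)   ∎

  Σᶠ-neg : ∀ v (g : Fin v → ℤ) → Σᶠ v (λ z → - g z) ≡ - Σᶠ v g
  Σᶠ-neg v g = begin
    Σᶠ v (λ z → - g z)       ≡⟨ Σᶠ-cong v (λ z → ℤ.-1*i≡-i (g z)) ⟨
    Σᶠ v (λ z → -1ℤ * g z)   ≡⟨ *-distribˡ-Σᶠ v -1ℤ g ⟨
    -1ℤ * Σᶠ v g             ≡⟨ ℤ.-1*i≡-i (Σᶠ v g) ⟩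
    - Σᶠ v g                 ∎

  Σᶠ-distrib-- : ∀ v (g h : Fin v → ℤ) → Σᶠ v (λ z → g z - h z) ≡ Σᶠ v g - Σᶠ v h
  Σᶠ-distrib-- v g h =
    trans (Σᶠ-distrib-+ v g (λ z → - h z)) (cong (_+_ (Σᶠ v g)) (Σᶠ-neg v h))

  Σᶠ-linear : ∀ v p q (g h : Fin v → ℤ) →
    Σᶠ v (λ z → p * g z + q * h z) ≡ p * Σᶠ v g + q * Σᶠ v h
  Σᶠ-linear v p q g h = begin
    Σᶠ v (λ z → p * g z + q * h z)                    ≡⟨ Σᶠ-distrib-+ v _ _ ⟩
    Σᶠ v (λ z → p * g z) + Σᶠ v (λ z → q * h z)       ≡⟨ cong₂ _+_ (*-distribˡ-Σᶠ v p g) (*-distribˡ-Σᶠ v q h) ⟨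
    p * Σᶠ v g + q * Σᶠ v h                           ∎

  Σᶠ-affine : ∀ v σ τ (g : Fin v → ℤ) →
    Σᶠ v (λ z → σ * g z + τ * (1ℤ - g z)) ≡ (σ - τ) * Σᶠ v g + τ * + v
  Σᶠ-affine v σ τ g = begin
    Σᶠ v (λ z → σ * g z + τ * (1ℤ - g z))        ≡⟨ Σᶠ-cong v (λ z → regroup σ τ (g z)) ⟩
    Σᶠ v (λ z → (σ - τ) * g z + τ * 1ℤ)           ≡⟨ Σᶠ-linear v (σ - τ) τ g (λ _ → 1ℤ) ⟩
    (σ - τ) * Σᶠ v g + τ * Σᶠ v (λ _ → 1ℤ)        ≡⟨ cong (λ w → (σ - τ) * Σᶠ v g + τ * w) (Σᶠ-one v) ⟩
    (σ - τ) * Σᶠ v g + τ * + v                    ∎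
    where
    regroup : ∀ σ τ c → σ * c + τ * (1ℤ - c) ≡ (σ - τ) * c + τ * 1ℤ
    regroup = solve-∀

  Σᶠ-comm : ∀ a b (g : Fin a → Fin b → ℤ) →
    Σᶠ a (λ z → Σᶠ b (g z)) ≡ Σᶠ b (λ w → Σᶠ a (λ z → g z w))
  Σᶠ-comm a b g = begin
    Σᶠ a (λ z → Σᶠ b (g z))             ≡⟨ Σᶠ-cong a (λ z → Σᶠ≡sum b (g z)) ⟩
    Σᶠ a (λ z → sum (g z))              ≡⟨ Σᶠ≡sum a _ ⟩
    sum (λ z → sum (g z))               ≡⟨ ∑-comm g ⟩
    sum (λ w → sum (λ z → g z w))       ≡⟨ Σᶠ≡sum b _ ⟨
    Σᶠ b (λ w → sum (λ z → g z w))      ≡⟨ Σᶠ-cong b (λ w → Σᶠ≡sum a _) ⟨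
    Σᶠ b (λ w → Σᶠ a (λ z → g z w))     ∎

  ·-assoc : ∀ {v} (X Y Z : Mat v) x y → (X · (Y · Z)) x y ≡ ((X · Y) · Z) x y
  ·-assoc {v} X Y Z x y = begin
    Σᶠ v (λ z → X x z * Σᶠ v (λ w → Y z w * Z w y))
      ≡⟨ Σᶠ-cong v (λ z → *-distribˡ-Σᶠ v (X x z) _) ⟩
    Σᶠ v (λ z → Σᶠ v (λ w → X x z * (Y z w * Z w y)))
      ≡⟨ Σᶠ-comm v v _ ⟩
    Σᶠ v (λ w → Σᶠ v (λ z → X x z * (Y z w * Z w y)))
      ≡⟨ Σᶠ-cong v (λ w → Σᶠ-cong v (λ z → ℤ.*-assoc (X x z) (Y z w) (Z w y))) ⟨
    Σᶠ v (λ w → Σᶠ v (λ z → X x z * Y z w * Z w y))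
      ≡⟨ Σᶠ-cong v (λ w → *-distribʳ-Σᶠ v (Z w y) _) ⟨
    Σᶠ v (λ w → Σᶠ v (λ z → X x z * Y z w) * Z w y)
      ∎

  ·-congˡ : ∀ {v} (X X′ Y : Mat v) {x x′} → (∀ z → X x z ≡ X′ x′ z) →
    ∀ y → (X · Y) x y ≡ (X′ · Y) x′ y
  ·-congˡ {v} X X′ Y rows y = Σᶠ-cong v (λ z → cong (_* Y z y) (rows z))

  ·-congʳ : ∀ {v} (X : Mat v) {Y Y′ : Mat v} → (∀ z y → Y z y ≡ Y′ z y) →
    ∀ x y → (X · Y) x y ≡ (X · Y′) x y
  ·-congʳ {v} X Y≗Y′ x y = Σᶠ-cong v (λ z → cong (X x z *_) (Y≗Y′ z y))

  Σᶠ-row-· : ∀ {v} (X Y : Mat v) {r} → (∀ z → Σᶠ v (Y z) ≡ r) →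
    ∀ x → Σᶠ v ((X · Y) x) ≡ Σᶠ v (X x) * r
  Σᶠ-row-· {v} X Y {r} rows x = begin
    Σᶠ v (λ y → Σᶠ v (λ z → X x z * Y z y))  ≡⟨ Σᶠ-comm v v _ ⟨
    Σᶠ v (λ z → Σᶠ v (λ y → X x z * Y z y))  ≡⟨ Σᶠ-cong v (λ z → *-distribˡ-Σᶠ v (X x z) (Y z)) ⟨
    Σᶠ v (λ z → X x z * Σᶠ v (Y z))          ≡⟨ Σᶠ-cong v (λ z → cong (X x z *_) (rows z)) ⟩
    Σᶠ v (λ z → X x z * r)                   ≡⟨ *-distribʳ-Σᶠ v r (X x) ⟨
    Σᶠ v (X x) * r                           ∎

  ·-affine : ∀ {v} (X C : Mat v) σ τ x y →
    Σᶠ v (λ z → X x z * (σ * C z y + τ * (1ℤ - C z y))) ≡ (σ - τ) * (X · C) x y + τ * Σᶠ v (X x)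
  ·-affine {v} X C σ τ x y = begin
    Σᶠ v (λ z → X x z * (σ * C z y + τ * (1ℤ - C z y)))
      ≡⟨ Σᶠ-cong v (λ z → regroup σ τ (X x z) (C z y)) ⟩
    Σᶠ v (λ z → (σ - τ) * (X x z * C z y) + τ * X x z)
      ≡⟨ Σᶠ-linear v (σ - τ) τ _ (X x) ⟩
    (σ - τ) * (X · C) x y + τ * Σᶠ v (X x)
      ∎
    where
    regroup : ∀ σ τ a c → a * (σ * c + τ * (1ℤ - c)) ≡ (σ - τ) * (a * c) + τ * a
    regroup = solve-∀

  zeroOne-idem : ∀ {a} → (a ≡ 0ℤ) ⊎ (a ≡ 1ℤ) → a * a ≡ a
  zeroOne-idem (inj₁ refl) = refl
  zeroOne-idem (inj₂ refl) = refl

  zeroOne-*-complement : ∀ {a} → (a ≡ 0ℤ) ⊎ (a ≡ 1ℤ) → a * (1ℤ - a) ≡ 0ℤ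
  zeroOne-*-complement (inj₁ refl) = refl
  zeroOne-*-complement (inj₂ refl) = refl

  Iₘ-diag : ∀ v (x : Fin v) → Iₘ v x x ≡ 1ℤ
  Iₘ-diag v x rewrite dec-true (x ≟ x) refl = refl

  Iₘ-offDiag : ∀ v {x y : Fin v} → x ≢ y → Iₘ v x y ≡ 0ℤ
  Iₘ-offDiag v {x} {y} x≢y rewrite dec-false (x ≟ y) x≢y = refl

  Iₘ-sym : ∀ v (x y : Fin v) → Iₘ v x y ≡ Iₘ v y x
  Iₘ-sym v x y with x ≟ y
  ... | yes refl = sym (Iₘ-diag v x)
  ... | no x≢y   = sym (Iₘ-offDiag v (λ y≡x → x≢y (sym y≡x)))

  Σᶠ-Iₘ : ∀ v (x : Fin v) (g : Fin v → ℤ) → Σᶠ v (λ z → Iₘ v x z * g z) ≡ g x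
  Σᶠ-Iₘ (suc v) fzero g = begin
    1ℤ * g fzero + Σᶠ v (λ _ → 0ℤ)  ≡⟨ cong₂ _+_ (ℤ.*-identityˡ (g fzero)) (Σᶠ-zero v) ⟩
    g fzero + 0ℤ                     ≡⟨ ℤ.+-identityʳ (g fzero) ⟩
    g fzero                          ∎
  Σᶠ-Iₘ (suc v) (fsuc x) g =
    trans (ℤ.+-identityˡ _) (Σᶠ-Iₘ v x (λ z → g (fsuc z)))

  ⟦_<_⟧ : ℕ → ℕ → ℤ
  ⟦ i < n ⟧ = if does (i ℕ.<? n) then 1ℤ else 0ℤ

  ⟦<⟧-yes : ∀ {i n} → i ℕ.< n → ⟦ i < n ⟧ ≡ 1ℤ
  ⟦<⟧-yes {i} {n} i<n rewrite dec-true (i ℕ.<? n) i<n = refl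

  ⟦<⟧-no : ∀ {i n} → ¬ i ℕ.< n → ⟦ i < n ⟧ ≡ 0ℤ
  ⟦<⟧-no {i} {n} i≮n rewrite dec-false (i ℕ.<? n) i≮n = refl

  Σᶠ-⟦<⟧ : ∀ {v n} → n ≤ v → Σᶠ v (λ z → ⟦ toℕ z < n ⟧) ≡ + n
  Σᶠ-⟦<⟧ {v}     {zero}  _           = Σᶠ-zero v
  Σᶠ-⟦<⟧ {suc v} {suc n} (s≤s n≤v)   = cong (_+_ 1ℤ) (Σᶠ-⟦<⟧ n≤v)

  module _ (m n : ℕ) .{{_ : NonZero n}} where

    IkronJ-sameGroup : ∀ {x y} → toℕ x / n ≡ toℕ y / n → IkronJ m n x y ≡ 1ℤ
    IkronJ-sameGroup {x} {y} eq rewrite dec-true (toℕ x / n ℕ.≟ toℕ y / n) eq = refl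

    IkronJ-otherGroup : ∀ {x y} → toℕ x / n ≢ toℕ y / n → IkronJ m n x y ≡ 0ℤ
    IkronJ-otherGroup {x} {y} neq rewrite dec-false (toℕ x / n ℕ.≟ toℕ y / n) neq = refl

    IkronJ-zeroOne : IsZeroOne (IkronJ m n)
    IkronJ-zeroOne x y with toℕ x / n ℕ.≟ toℕ y / n
    ... | yes eq  = inj₂ (IkronJ-sameGroup eq)
    ... | no neq  = inj₁ (IkronJ-otherGroup neq)

    IkronJ-sym : ∀ x y → IkronJ m n x y ≡ IkronJ m n y x
    IkronJ-sym x y with toℕ x / n ℕ.≟ toℕ y / n
    ... | yes eq  = trans (IkronJ-sameGroup eq) (sym (IkronJ-sameGroup (sym eq)))
    ... | no neq  = trans (IkronJ-otherGroup neq) (sym (IkronJ-otherGroup (λ eq → neq (sym eq))))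

    IkronJ-rows-sameGroup : ∀ {x x′} → toℕ x / n ≡ toℕ x′ / n →
      ∀ z → IkronJ m n x z ≡ IkronJ m n x′ z
    IkronJ-rows-sameGroup {x} {x′} eq z with toℕ x / n ℕ.≟ toℕ z / n
    ... | yes eq′ = trans (IkronJ-sameGroup eq′) (sym (IkronJ-sameGroup (trans (sym eq) eq′)))
    ... | no neq  = trans (IkronJ-otherGroup neq) (sym (IkronJ-otherGroup (λ eq′ → neq (trans eq eq′))))

    IkronJ-firstGroup : ∀ {x} → toℕ x ℕ.< n → ∀ z → IkronJ m n x z ≡ ⟦ toℕ z < n ⟧
    IkronJ-firstGroup x<n z with toℕ z ℕ.<? n
    ... | yes z<n = trans (IkronJ-sameGroup (trans (m<n⇒m/n≡0 x<n) (sym (m<n⇒m/n≡0 z<n))))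
                          (sym (⟦<⟧-yes z<n))
    ... | no z≮n  = trans (IkronJ-otherGroup (λ eq →
                            ℕ.<-irrefl (trans (sym (m<n⇒m/n≡0 x<n)) eq) (m≥n⇒m/n>0 (ℕ.≮⇒≥ z≮n))))
                          (sym (⟦<⟧-no z≮n))

  IkronJ-rowSum-firstGroup : ∀ m n .{{_ : NonZero n}} {x : Fin (m ℕ.* n)} → toℕ x ℕ.< n →
    Σᶠ (m ℕ.* n) (IkronJ m n x) ≡ + n
  IkronJ-rowSum-firstGroup zero    n {()}
  IkronJ-rowSum-firstGroup (suc m) n x<n =
    trans (Σᶠ-cong (suc m ℕ.* n) (IkronJ-firstGroup (suc m) n x<n)) (Σᶠ-⟦<⟧ (ℕ.m≤m+n n (m ℕ.* n)))

module Designs where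

  open Matrices
  open import Data.Fin.Base using (toℕ)
  open import Data.Integer.Base using (+_; 0ℤ; 1ℤ; _+_; _*_; _-_)
  import Data.Integer.Properties as ℤ
  open import Data.Integer.Tactic.RingSolver using (solve-∀)
  open import Data.Nat.Base using (_/_)
  open import Relation.Binary.PropositionalEquality using (cong; cong₂; trans; module ≡-Reasoning)
  open import Relation.Nullary using (¬_)
  open ≡-Reasoning

  module _ (k m n λ₁ λ₂ : ℕ) .{{_ : NonZero n}} where

    private
      v : ℕ
      v = m ℕ.* n

    -- Definitionally the matrix G in IsSGDD, so the fields of a design can be used at this type.
    Gram : Mat v
    Gram = ((+ k) ⋆ Iₘ v)
      +ₘ (((+ λ₁) ⋆ (IkronJ m n -ₘ Iₘ v)) +ₘ ((+ λ₂) ⋆ (Jₘ v -ₘ IkronJ m n)))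

    Gram-diag : ∀ x → Gram x x ≡ + k
    Gram-diag x rewrite Iₘ-diag v x | IkronJ-sameGroup m n {x} {x} refl =
      evaluate (+ k) (+ λ₁) (+ λ₂)
      where
      evaluate : ∀ k l₁ l₂ → k * 1ℤ + (l₁ * (1ℤ - 1ℤ) + l₂ * (1ℤ - 1ℤ)) ≡ k
      evaluate = solve-∀

    Gram-sameGroup : ∀ {x y} → x ≢ y → toℕ x / n ≡ toℕ y / n → Gram x y ≡ + λ₁
    Gram-sameGroup x≢y eq rewrite Iₘ-offDiag v x≢y | IkronJ-sameGroup m n eq =
      evaluate (+ k) (+ λ₁) (+ λ₂)
      where
      evaluate : ∀ k l₁ l₂ → k * 0ℤ + (l₁ * (1ℤ - 0ℤ) + l₂ * (1ℤ - 1ℤ)) ≡ l₁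
      evaluate = solve-∀

    module _ {A : Mat v} (design : IsSGDD k m n λ₁ λ₂ A) where

      design-·ᵀ : ∀ x y → (A · transpose A) x y ≡ Gram x y
      design-·ᵀ = proj₁ (proj₂ (proj₂ (proj₂ design)))

      designᵀ-· : ∀ x y → (transpose A · A) x y ≡ Gram x y
      designᵀ-· = proj₂ (proj₂ (proj₂ (proj₂ design)))

      design-rowSum : ∀ x → Σᶠ v (A x) ≡ + k
      design-rowSum x = begin
        Σᶠ v (A x)                       ≡⟨ Σᶠ-cong v (λ z → zeroOne-idem (proj₁ design x z)) ⟨
        Σᶠ v (λ z → A x z * A x z)       ≡⟨ design-·ᵀ x x ⟩
        Gram x x                               ≡⟨ Gram-diag x ⟩
        + k                                    ∎

      design-colSum : ∀ y → Σᶠ v (λ z → A z y) ≡ + k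
      design-colSum y = begin
        Σᶠ v (λ z → A z y)               ≡⟨ Σᶠ-cong v (λ z → zeroOne-idem (proj₁ design z y)) ⟨
        Σᶠ v (λ z → A z y * A z y)       ≡⟨ designᵀ-· y y ⟩
        Gram y y                               ≡⟨ Gram-diag y ⟩
        + k                                    ∎

      design-rows-differ : λ₁ ≢ k → ∀ {x x′} → x ≢ x′ → toℕ x / n ≡ toℕ x′ / n →
        ¬ (∀ z → A x z ≡ A x′ z)
      design-rows-differ λ₁≢k {x} {x′} x≢x′ eq rows = λ₁≢k (ℤ.+-injective (begin
        + λ₁                          ≡⟨ Gram-sameGroup x≢x′ eq ⟨
        Gram x x′                     ≡⟨ design-·ᵀ x x′ ⟨
        Σᶠ v (λ z → A x z * A x′ z)   ≡⟨ Σᶠ-cong v (λ z → cong (A x z *_) (rows z)) ⟨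
        Σᶠ v (λ z → A x z * A x z)    ≡⟨ design-·ᵀ x x ⟩
        Gram x x                      ≡⟨ Gram-diag x ⟩
        + k                           ∎))

  module _ (k m n μ : ℕ) .{{_ : NonZero n}} where

    private
      v : ℕ
      v = m ℕ.* n
      G K : Mat v
      G = Gram k m n 0 μ
      K = IkronJ m n

    Gram₀-entry : ∀ x y → G x y ≡ + k * Iₘ v x y + + μ * (1ℤ - K x y)
    Gram₀-entry x y = simplify (+ k) (+ μ) (Iₘ v x y) (K x y)
      where
      simplify : ∀ k μ i c → k * i + (+ 0 * (c - i) + μ * (1ℤ - c)) ≡ k * i + μ * (1ℤ - c)
      simplify = solve-∀

    Gram₀-· : ∀ (X : Mat v) x y →
      (G · X) x y ≡ + k * X x y + + μ * (Σᶠ v (λ z → X z y) - (K · X) x y)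
    Gram₀-· X x y = begin
      Σᶠ v (λ z → G x z * X z y)
        ≡⟨ Σᶠ-cong v (λ z → trans (cong (_* X z y) (Gram₀-entry x z))
                                          (expand (+ k) (+ μ) (Iₘ v x z) (K x z) (X z y))) ⟩
      Σᶠ v (λ z → + k * (Iₘ v x z * X z y) + + μ * (X z y - K x z * X z y))
        ≡⟨ Σᶠ-linear v (+ k) (+ μ) _ _ ⟩
      + k * Σᶠ v (λ z → Iₘ v x z * X z y) + + μ * Σᶠ v (λ z → X z y - K x z * X z y)
        ≡⟨ cong₂ (λ p q → + k * p + + μ * q) (Σᶠ-Iₘ v x (λ z → X z y)) (Σᶠ-distrib-- v _ _) ⟩
      + k * X x y + + μ * (Σᶠ v (λ z → X z y) - (K · X) x y)
        ∎
      where
      expand : ∀ k μ i c a → (k * i + μ * (1ℤ - c)) * a ≡ k * (i * a) + μ * (a - c * a)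
      expand = solve-∀

    Gram₀-rowSum-firstGroup : ∀ {x} → toℕ x ℕ.< n →
      Σᶠ v (G x) ≡ + k + + μ * (+ v - + n)
    Gram₀-rowSum-firstGroup {x} x<n = begin
      Σᶠ v (G x)
        ≡⟨ Σᶠ-cong v (λ z → trans (Gram₀-entry x z) (regroup (+ k) (+ μ) (Iₘ v x z) (K x z))) ⟩
      Σᶠ v (λ z → + k * (Iₘ v x z * 1ℤ) + + μ * (1ℤ - K x z))
        ≡⟨ Σᶠ-linear v (+ k) (+ μ) _ _ ⟩
      + k * Σᶠ v (λ z → Iₘ v x z * 1ℤ) + + μ * Σᶠ v (λ z → 1ℤ - K x z)
        ≡⟨ cong₂ (λ p q → + k * p + + μ * q) (Σᶠ-Iₘ v x (λ _ → 1ℤ)) (Σᶠ-distrib-- v _ _) ⟩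
      + k * 1ℤ + + μ * (Σᶠ v (λ _ → 1ℤ) - Σᶠ v (K x))
        ≡⟨ cong₂ (λ p q → p + + μ * q) (ℤ.*-identityʳ (+ k))
                 (cong₂ _-_ (Σᶠ-one v) (IkronJ-rowSum-firstGroup m n x<n)) ⟩
      + k + + μ * (+ v - + n)
        ∎
      where
      regroup : ∀ k μ i c → k * i + μ * (1ℤ - c) ≡ k * (i * 1ℤ) + μ * (1ℤ - c)
      regroup = solve-∀

    IkronJ·Gram₀-diag : ∀ x → (K · G) x x ≡ + k
    IkronJ·Gram₀-diag x = begin
      Σᶠ v (λ z → K x z * G z x)                  ≡⟨ Σᶠ-cong v entry ⟩
      Σᶠ v (λ z → + k * (Iₘ v x z * K x z))  ≡⟨ *-distribˡ-Σᶠ v (+ k) _ ⟨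
      + k * Σᶠ v (λ z → Iₘ v x z * K x z)    ≡⟨ cong (+ k *_) (Σᶠ-Iₘ v x (K x)) ⟩
      + k * K x x                                        ≡⟨ cong (+ k *_) (IkronJ-sameGroup m n {x} {x} refl) ⟩
      + k * 1ℤ                                           ≡⟨ ℤ.*-identityʳ (+ k) ⟩
      + k                                                ∎
      where
      expand : ∀ k μ i c → c * (k * i + μ * (1ℤ - c)) ≡ k * (i * c) + μ * (c * (1ℤ - c))
      expand = solve-∀
      entry : ∀ z → K x z * G z x ≡ + k * (Iₘ v x z * K x z)
      entry z = begin
        K x z * G z x
          ≡⟨ cong (K x z *_) (Gram₀-entry z x) ⟩
        K x z * (+ k * Iₘ v z x + + μ * (1ℤ - K z x))
          ≡⟨ cong₂ (λ i c → K x z * (+ k * i + + μ * (1ℤ - c))) (Iₘ-sym v z x) (IkronJ-sym m n z x) ⟩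
        K x z * (+ k * Iₘ v x z + + μ * (1ℤ - K x z))
          ≡⟨ expand (+ k) (+ μ) (Iₘ v x z) (K x z) ⟩
        + k * (Iₘ v x z * K x z) + + μ * (K x z * (1ℤ - K x z))
          ≡⟨ cong (λ w → + k * (Iₘ v x z * K x z) + + μ * w) (zeroOne-*-complement (IkronJ-zeroOne m n x z)) ⟩
        + k * (Iₘ v x z * K x z) + + μ * 0ℤ
          ≡⟨ cong (_+_ (+ k * (Iₘ v x z * K x z))) (ℤ.*-zeroʳ (+ μ)) ⟩
        + k * (Iₘ v x z * K x z) + 0ℤ
          ≡⟨ ℤ.+-identityʳ _ ⟩
        + k * (Iₘ v x z * K x z)
          ∎

module ParameterArithmetic where

  open Integers
  open import Data.Integer.Base using (ℤ; +_; 0ℤ; 1ℤ; _+_; _*_; _-_; ∣_∣; -[1+_])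
  import Data.Integer.Properties as ℤ
  open import Data.Integer.Tactic.RingSolver using (solve)
  open import Data.List.Base using ([]; _∷_)
  open import Data.Nat.Base using (_^_)
  import Data.Nat.Properties as ℕ
  import Data.Nat.Tactic.RingSolver as ℕ-Solver
  open import Data.Sum.Base using ([_,_]′)
  open import Relation.Binary.PropositionalEquality using (cong; cong₂; trans; module ≡-Reasoning)
  open ≡-Reasoning

  module Solution (K M N U s τ : ℤ) (K≢0 : K ≢ 0ℤ) (K≢1 : K ≢ 1ℤ) (N≢0 : N ≢ 0ℤ)
    (K≡s² : K ≡ s * s)
    (K²≡sK+τMN : K * K ≡ s * K + τ * (M * N))
    (K²≡K+U[MN-N] : K * K ≡ K + U * (M * N - N))
    (U≡UK-sτ-τK : U ≡ U * K - s * τ - τ * K)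
    where

    τMN≡K²-sK : τ * (M * N) ≡ K * K - s * K
    τMN≡K²-sK = isolateʳ K²≡sK+τMN

    UK-U≡sτ+τK : U * K - U ≡ s * τ + τ * K
    UK-U≡sτ+τK = begin
      U * K - U                          ≡⟨ cong (λ w → U * K - w) U≡UK-sτ-τK ⟩
      U * K - (U * K - s * τ - τ * K)    ≡⟨ solve (U ∷ K ∷ s ∷ τ ∷ []) ⟩
      s * τ + τ * K                      ∎

    UMN≡K² : U * (M * N) ≡ K * K
    UMN≡K² = cancelˡ (λ K-1≡0 → K≢1 (ℤ.i-j≡0⇒i≡j K 1ℤ K-1≡0)) (begin
      (K - 1ℤ) * (U * (M * N))    ≡⟨ solve (K ∷ U ∷ M ∷ N ∷ []) ⟩
      (U * K - U) * (M * N)       ≡⟨ cong (_* (M * N)) UK-U≡sτ+τK ⟩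
      (s * τ + τ * K) * (M * N)   ≡⟨ solve (s ∷ τ ∷ K ∷ M ∷ N ∷ []) ⟩
      (s + K) * (τ * (M * N))     ≡⟨ cong ((s + K) *_) τMN≡K²-sK ⟩
      (s + K) * (K * K - s * K)   ≡⟨ solve (s ∷ K ∷ []) ⟩
      K * (K * K - s * s)         ≡⟨ cong (λ w → K * (K * K - w)) K≡s² ⟨
      K * (K * K - K)             ≡⟨ solve (K ∷ []) ⟩
      (K - 1ℤ) * (K * K)          ∎)

    UN≡K : U * N ≡ K
    UN≡K = begin
      U * N                                  ≡⟨ solve (U ∷ M ∷ N ∷ K ∷ []) ⟩
      K + U * (M * N) - (K + U * (M * N - N))
        ≡⟨ cong₂ (λ p q → K + p - q) (sym UMN≡K²) K²≡K+U[MN-N] ⟨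
      K + K * K - K * K                      ≡⟨ solve (K ∷ []) ⟩
      K                                      ∎

    M≡K : M ≡ K
    M≡K = cancelˡ K≢0 (begin
      K * M          ≡⟨ cong (_* M) UN≡K ⟨
      U * N * M      ≡⟨ solve (U ∷ N ∷ M ∷ []) ⟩
      U * (M * N)    ≡⟨ UMN≡K² ⟩
      K * K          ∎)

    τN≡K-s : τ * N ≡ K - s
    τN≡K-s = cancelˡ K≢0 (begin
      K * (τ * N)      ≡⟨ cong (_* (τ * N)) M≡K ⟨
      M * (τ * N)      ≡⟨ solve (M ∷ τ ∷ N ∷ []) ⟩
      τ * (M * N)      ≡⟨ τMN≡K²-sK ⟩
      K * K - s * K    ≡⟨ solve (K ∷ s ∷ []) ⟩
      K * (K - s)      ∎)

    s≡N[U-τ] : s ≡ N * (U - τ)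
    s≡N[U-τ] = sym (begin
      N * (U - τ)      ≡⟨ solve (N ∷ U ∷ τ ∷ []) ⟩
      U * N - τ * N    ≡⟨ cong₂ _-_ UN≡K τN≡K-s ⟩
      K - (K - s)      ≡⟨ solve (K ∷ s ∷ []) ⟩
      s                ∎)

    K≡N²[U-τ]² : K ≡ N * N * ((U - τ) * (U - τ))
    K≡N²[U-τ]² = begin
      K                                 ≡⟨ K≡s² ⟩
      s * s                             ≡⟨ cong (λ w → w * w) s≡N[U-τ] ⟩
      N * (U - τ) * (N * (U - τ))       ≡⟨ solve (N ∷ U ∷ τ ∷ []) ⟩
      N * N * ((U - τ) * (U - τ))       ∎

    U≡N[U-τ]² : U ≡ N * ((U - τ) * (U - τ))
    U≡N[U-τ]² = cancelˡ N≢0 (begin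
      N * U                              ≡⟨ ℤ.*-comm N U ⟩
      U * N                              ≡⟨ UN≡K ⟩
      K                                  ≡⟨ K≡N²[U-τ]² ⟩
      N * N * ((U - τ) * (U - τ))        ≡⟨ ℤ.*-assoc N N _ ⟩
      N * (N * ((U - τ) * (U - τ)))      ∎)

  i*i≡∣i∣*∣i∣ : ∀ i → i * i ≡ + (∣ i ∣ ℕ.* ∣ i ∣)
  i*i≡∣i∣*∣i∣ (+ a)    = sym (ℤ.pos-* a a)
  i*i≡∣i∣*∣i∣ -[1+ a ] = refl

  -- The ring solver cannot parse ℕ powers, so these identities are stated with the powers unfolded.
  private
    n²l² : ∀ n l → n ℕ.* n ℕ.* (l ℕ.* l) ≡ n ℕ.* (n ℕ.* 1) ℕ.* (l ℕ.* (l ℕ.* 1))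
    n²l² = ℕ-Solver.solve-∀
    n³l² : ∀ n l → n ℕ.* n ℕ.* (l ℕ.* l) ℕ.* n ≡ n ℕ.* (n ℕ.* (n ℕ.* 1)) ℕ.* (l ℕ.* (l ℕ.* 1))
    n³l² = ℕ-Solver.solve-∀
    nl² : ∀ n l → n ℕ.* (l ℕ.* l) ≡ n ℕ.* (l ℕ.* (l ℕ.* 1))
    nl² = ℕ-Solver.solve-∀

  SquareParameters : (k m n μ : ℕ) → Set
  SquareParameters k m n μ = Σ ℕ (λ l → 0 ℕ.< l ×
    (m ℕ.* n ≡ n ^ 3 ℕ.* l ^ 2) × (k ≡ n ^ 2 ℕ.* l ^ 2) × (m ≡ n ^ 2 ℕ.* l ^ 2) × (μ ≡ n ℕ.* l ^ 2))

  squareParameters-from-identities : ∀ k m n μ (s τ : ℤ) → 0 ℕ.< k → μ ≢ 0 → 2 ℕ.≤ m → 0 ℕ.< n →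
    + k ≡ s * s →
    + k * + k ≡ s * + k + τ * (+ m * + n) →
    + k * + k ≡ + k + + μ * (+ m * + n - + n) →
    + μ ≡ + μ * + k - s * τ - τ * + k →
    SquareParameters k m n μ
  squareParameters-from-identities k m n μ s τ 0<k μ≢0 2≤m 0<n k≡s² k²≡sk+τmn k²≡k+μ[mn-n] μ≡μk-sτ-τk =
    l , 0<l , mn≡n³l² , k≡n²l² , m≡n²l² , μ≡nl²
    where
    +k≢0 : + k ≢ 0ℤ
    +k≢0 k≡0 = ℕ.<⇒≢ 0<k (sym (ℤ.+-injective k≡0))

    +n≢0 : + n ≢ 0ℤ
    +n≢0 n≡0 = ℕ.<⇒≢ 0<n (sym (ℤ.+-injective n≡0))

    +k≢1 : + k ≢ 1ℤ
    +k≢1 k≡1 =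
      [ (λ μ≡0 → μ≢0 (ℤ.+-injective μ≡0)) , mn-n≢0 ]′ (ℤ.i*j≡0⇒i≡0∨j≡0 (+ μ) μ[mn-n]≡0)
      where
      μ[mn-n]≡0 : + μ * (+ m * + n - + n) ≡ 0ℤ
      μ[mn-n]≡0 = trans (isolateʳ k²≡k+μ[mn-n]) (cong (λ w → w * w - w) k≡1)
      mn-n≢0 : + m * + n - + n ≢ 0ℤ
      mn-n≢0 mn-n≡0 = ℕ.<⇒≢ 2≤m (sym (ℤ.+-injective
        (cancelʳ +n≢0 (trans (ℤ.i-j≡0⇒i≡j _ _ mn-n≡0) (sym (ℤ.*-identityˡ (+ n)))))))

    open Solution (+ k) (+ m) (+ n) (+ μ) s τ +k≢0 +k≢1 +n≢0 k≡s² k²≡sk+τmn k²≡k+μ[mn-n] μ≡μk-sτ-τk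

    l : ℕ
    l = ∣ + μ - τ ∣

    k≡n²l² : k ≡ n ^ 2 ℕ.* l ^ 2
    k≡n²l² = ℤ.+-injective (begin
      + k                                     ≡⟨ K≡N²[U-τ]² ⟩
      + n * + n * ((+ μ - τ) * (+ μ - τ))     ≡⟨ cong (+ n * + n *_) (i*i≡∣i∣*∣i∣ (+ μ - τ)) ⟩
      + n * + n * + (l ℕ.* l)                 ≡⟨ cong (_* + (l ℕ.* l)) (ℤ.pos-* n n) ⟨
      + (n ℕ.* n) * + (l ℕ.* l)               ≡⟨ ℤ.pos-* (n ℕ.* n) (l ℕ.* l) ⟨
      + (n ℕ.* n ℕ.* (l ℕ.* l))               ≡⟨ cong +_ (n²l² n l) ⟩
      + (n ^ 2 ℕ.* l ^ 2)                     ∎)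

    m≡n²l² : m ≡ n ^ 2 ℕ.* l ^ 2
    m≡n²l² = trans (ℤ.+-injective M≡K) k≡n²l²

    mn≡n³l² : m ℕ.* n ≡ n ^ 3 ℕ.* l ^ 2
    mn≡n³l² = trans (cong (ℕ._* n) (trans m≡n²l² (sym (n²l² n l)))) (n³l² n l)

    μ≡nl² : μ ≡ n ℕ.* l ^ 2
    μ≡nl² = ℤ.+-injective (begin
      + μ                             ≡⟨ U≡N[U-τ]² ⟩
      + n * ((+ μ - τ) * (+ μ - τ))   ≡⟨ cong (+ n *_) (i*i≡∣i∣*∣i∣ (+ μ - τ)) ⟩
      + n * + (l ℕ.* l)               ≡⟨ ℤ.pos-* n (l ℕ.* l) ⟨
      + (n ℕ.* (l ℕ.* l))             ≡⟨ cong +_ (nl² n l) ⟩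
      + (n ℕ.* l ^ 2)                 ∎)

    0<l : 0 ℕ.< l
    0<l = ℕ.n≢0⇒n>0 (λ l≡0 → ℕ.<⇒≢ 0<k (sym (begin
      k                  ≡⟨ k≡n²l² ⟩
      n ^ 2 ℕ.* l ^ 2    ≡⟨ cong (λ i → n ^ 2 ℕ.* i ^ 2) l≡0 ⟩
      n ^ 2 ℕ.* 0        ≡⟨ ℕ.*-zeroʳ (n ^ 2) ⟩
      0                  ∎)))

module LinkedTriple
  (k m n μ : ℕ) .{{_ : NonZero n}} {f : ℕ} {A : Fin f → Fin f → Mat (m ℕ.* n)}
  (linked : IsLinkedSystem f k m n 0 μ A)
  {a b c : Fin f} (a≢b : a ≢ b) (b≢c : b ≢ c) (a≢c : a ≢ c)
  where

  open Integers
  open Matrices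
  open Designs
  open ParameterArithmetic using (SquareParameters; squareParameters-from-identities)
  open import Data.Fin.Base using (toℕ)
  open import Data.Integer.Base using (ℤ; +_; 0ℤ; 1ℤ; _+_; _*_; _-_)
  import Data.Integer.Properties as ℤ
  open import Data.Integer.Tactic.RingSolver using (solve-∀)
  open import Data.Nat.Base using (_/_)
  open import Data.Nat.DivMod using (m<n⇒m/n≡0)
  import Data.Nat.Properties as ℕ
  open import Relation.Binary.PropositionalEquality using (cong; cong₂; trans; module ≡-Reasoning)
  open import Relation.Nullary using (yes; no; contradiction)
  open ≡-Reasoning

  σ τ s : ℤ
  σ = proj₁ (proj₂ (proj₂ linked))
  τ = proj₁ (proj₂ (proj₂ (proj₂ linked)))
  s = σ - τ

  private
    v : ℕ
    v = m ℕ.* n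
    G K P Q B C : Mat v
    G = Gram k m n 0 μ
    K = IkronJ m n
    P = A b a
    Q = A a b
    B = A b c
    C = A a c
    r : ℤ
    r = s * τ + τ * + k - + μ * + k

    b≢a : b ≢ a
    b≢a b≡a = a≢b (sym b≡a)

    design : ∀ {i j} → i ≢ j → IsSGDD k m n 0 μ (A i j)
    design = proj₁ (proj₂ linked) _ _

    rowSum : ∀ {i j} → i ≢ j → ∀ x → Σᶠ v (A i j x) ≡ + k
    rowSum i≢j = design-rowSum k m n 0 μ (design i≢j)

    linking : ∀ {i j l} → i ≢ j → j ≢ l → i ≢ l →
      ∀ x y → (A i j · A j l) x y ≡ σ * A i l x y + τ * (1ℤ - A i l x y)
    linking = proj₂ (proj₂ (proj₂ (proj₂ linked))) _ _ _

    P·Q≡G : ∀ x y → (P · Q) x y ≡ G x y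
    P·Q≡G x y = trans (·-congʳ P (λ z y → sym (proj₁ linked b a b≢a z y)) x y)
                      (design-·ᵀ k m n 0 μ (design b≢a) x y)

    Q·P≡G : ∀ x y → (Q · P) x y ≡ G x y
    Q·P≡G x y = trans (·-congʳ Q (λ z y → sym (proj₁ linked a b a≢b z y)) x y)
                      (design-·ᵀ k m n 0 μ (design a≢b) x y)

  0<k : 0 ℕ.< k
  0<k = proj₁ (proj₂ (design a≢b))

  private
    +k≢0 : + k ≢ 0ℤ
    +k≢0 k≡0 = ℕ.<⇒≢ 0<k (sym (ℤ.+-injective k≡0))

  two-expansions : ∀ x y →
    + k * B x y + + μ * (+ k - (K · B) x y) ≡ s * (σ * B x y + τ * (1ℤ - B x y)) + τ * + k
  two-expansions x y = begin
    + k * B x y + + μ * (+ k - (K · B) x y)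
      ≡⟨ cong (λ w → + k * B x y + + μ * (w - (K · B) x y)) (design-colSum k m n 0 μ (design b≢c) y) ⟨
    + k * B x y + + μ * (Σᶠ v (λ z → B z y) - (K · B) x y)
      ≡⟨ Gram₀-· k m n μ B x y ⟨
    (G · B) x y
      ≡⟨ ·-congˡ (P · Q) G B (P·Q≡G x) y ⟨
    ((P · Q) · B) x y
      ≡⟨ ·-assoc P Q B x y ⟨
    (P · (Q · B)) x y
      ≡⟨ ·-congʳ P (linking a≢b b≢c a≢c) x y ⟩
    Σᶠ v (λ z → P x z * (σ * C z y + τ * (1ℤ - C z y)))
      ≡⟨ ·-affine P C σ τ x y ⟩
    s * (P · C) x y + τ * Σᶠ v (P x)
      ≡⟨ cong₂ (λ p q → s * p + τ * q) (linking b≢a a≢c b≢c x y) (rowSum b≢a x) ⟩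
    s * (σ * B x y + τ * (1ℤ - B x y)) + τ * + k
      ∎

  B-scaled : ∀ x y → (+ k - s * s) * B x y ≡ + μ * (K · B) x y + r
  B-scaled x y = same-difference (two-expansions x y) (identity (+ k) (+ μ) σ τ (B x y) ((K · B) x y))
    where
    identity : ∀ k μ σ τ b kb →
      (k - (σ - τ) * (σ - τ)) * b - (μ * kb + ((σ - τ) * τ + τ * k - μ * k))
        ≡ (k * b + μ * (k - kb)) - ((σ - τ) * (σ * b + τ * (1ℤ - b)) + τ * k)
    identity = solve-∀

  k≡s² : ∀ {x x′} → x ≢ x′ → toℕ x / n ≡ toℕ x′ / n → + k ≡ s * s
  k≡s² {x} {x′} x≢x′ sameGroup with + k - s * s ℤ.≟ 0ℤ
  ... | yes d≡0 = ℤ.i-j≡0⇒i≡j _ _ d≡0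
  ... | no d≢0  = contradiction rows-equal
    (design-rows-differ k m n 0 μ (design b≢c) (ℕ.<⇒≢ 0<k) x≢x′ sameGroup)
    where
    rows-equal : ∀ y → B x y ≡ B x′ y
    rows-equal y = cancelˡ d≢0 (begin
      (+ k - s * s) * B x y   ≡⟨ B-scaled x y ⟩
      + μ * (K · B) x y + r
        ≡⟨ cong (λ w → + μ * w + r) (·-congˡ K K B (IkronJ-rows-sameGroup m n sameGroup) y) ⟩
      + μ * (K · B) x′ y + r  ≡⟨ B-scaled x′ y ⟨
      (+ k - s * s) * B x′ y  ∎)

  μ≡μk-sτ-τk : + k ≡ s * s → (x : Fin v) → + μ ≡ + μ * + k - s * τ - τ * + k
  μ≡μk-sτ-τk k≡s²′ x = cancelʳ +k≢0 (begin
    + μ * + k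
      ≡⟨ cong (+ μ *_) (IkronJ·Gram₀-diag k m n μ x) ⟨
    + μ * (K · G) x x
      ≡⟨ cong (+ μ *_) (·-congʳ K (design-·ᵀ k m n 0 μ (design b≢c)) x x) ⟨
    + μ * (K · (B · transpose B)) x x
      ≡⟨ cong (+ μ *_) (·-assoc K B (transpose B) x x) ⟩
    + μ * ((K · B) · transpose B) x x
      ≡⟨ *-distribˡ-Σᶠ v (+ μ) _ ⟩
    Σᶠ v (λ y → + μ * ((K · B) x y * B x y))
      ≡⟨ Σᶠ-cong v (λ y → trans (sym (ℤ.*-assoc (+ μ) _ _)) (cong (_* B x y) (μ·KB y))) ⟩
    Σᶠ v (λ y → R₀ * B x y)
      ≡⟨ *-distribˡ-Σᶠ v R₀ (B x) ⟨
    R₀ * Σᶠ v (B x)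
      ≡⟨ cong (R₀ *_) (rowSum b≢c x) ⟩
    R₀ * + k
      ∎)
    where
    R₀ : ℤ
    R₀ = + μ * + k - s * τ - τ * + k
    negate : ∀ k μ s τ → 0ℤ - (s * τ + τ * k - μ * k) ≡ μ * k - s * τ - τ * k
    negate = solve-∀
    μ·KB : ∀ y → + μ * (K · B) x y ≡ R₀
    μ·KB y = begin
      + μ * (K · B) x y          ≡⟨ isolateˡ (sym (B-scaled x y)) ⟩
      (+ k - s * s) * B x y - r  ≡⟨ cong (λ d → d * B x y - r) (ℤ.i≡j⇒i-j≡0 k≡s²′) ⟩
      0ℤ - r                     ≡⟨ negate (+ k) (+ μ) s τ ⟩
      R₀                         ∎

  k²≡sk+τv : (x : Fin v) → + k * + k ≡ s * + k + τ * (+ m * + n)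
  k²≡sk+τv x = begin
    + k * + k                                   ≡⟨ cong (_* + k) (rowSum a≢b x) ⟨
    Σᶠ v (Q x) * + k                            ≡⟨ Σᶠ-row-· Q B (rowSum b≢c) x ⟨
    Σᶠ v ((Q · B) x)                            ≡⟨ Σᶠ-cong v (linking a≢b b≢c a≢c x) ⟩
    Σᶠ v (λ y → σ * C x y + τ * (1ℤ - C x y))   ≡⟨ Σᶠ-affine v σ τ (C x) ⟩
    s * Σᶠ v (C x) + τ * + v                    ≡⟨ cong₂ (λ p q → s * p + τ * q) (rowSum a≢c x) (ℤ.pos-* m n) ⟩
    s * + k + τ * (+ m * + n)                   ∎

  k²≡k+μ[v-n] : {x : Fin v} → toℕ x ℕ.< n → + k * + k ≡ + k + + μ * (+ m * + n - + n)
  k²≡k+μ[v-n] {x} x<n = begin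
    + k * + k                            ≡⟨ cong (_* + k) (rowSum a≢b x) ⟨
    Σᶠ v (Q x) * + k                     ≡⟨ Σᶠ-row-· Q P (rowSum b≢a) x ⟨
    Σᶠ v ((Q · P) x)                     ≡⟨ Σᶠ-cong v (Q·P≡G x) ⟩
    Σᶠ v (G x)                           ≡⟨ Gram₀-rowSum-firstGroup k m n μ x<n ⟩
    + k + + μ * (+ v - + n)              ≡⟨ cong (λ w → + k + + μ * (w - + n)) (ℤ.pos-* m n) ⟩
    + k + + μ * (+ m * + n - + n)        ∎

  squareParameters : μ ≢ 0 → 2 ℕ.≤ m →
    ∀ {x x′ : Fin v} → x ≢ x′ → toℕ x ℕ.< n → toℕ x′ ℕ.< n → SquareParameters k m n μ
  squareParameters μ≢0 2≤m {x} x≢x′ x<n x′<n =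
    squareParameters-from-identities k m n μ s τ 0<k μ≢0 2≤m (ℕ.≤-<-trans ℕ.z≤n x<n)
      k≡s²′ (k²≡sk+τv x) (k²≡k+μ[v-n] x<n) (μ≡μk-sτ-τk k≡s²′ x)
    where
    k≡s²′ : + k ≡ s * s
    k≡s²′ = k≡s² x≢x′ (trans (m<n⇒m/n≡0 x<n) (sym (m<n⇒m/n≡0 x′<n)))

open import Data.Nat.Base using (_*_; _^_; _≥_; _<_; s≤s; z≤n)
open import Data.Product.Base using (∃; map₂)

corollary5p2 : (f k m n λ₁ λ₂ : ℕ) → .{{_ : NonZero n}} →
    f ≥ 3 → m ≥ 2 → n ≥ 2 →
    ∃ (λ (A : Fin f → Fin f → Mat (m * n)) → IsLinkedSystem f k m n λ₁ λ₂ A) →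
    λ₁ ≢ λ₂ →
    λ₁ ≡ 0 →
    Σ ℕ (λ l → 0 < l ×
      (m * n ≡ n ^ 3 * l ^ 2) × (k ≡ n ^ 2 * l ^ 2) × (m ≡ n ^ 2 * l ^ 2) ×
      (λ₁ ≡ 0) × (λ₂ ≡ n * l ^ 2))
-- Matching on the bounds makes f and m ℕ.* n reduce to successors, so the indices 0, 1, 2 and the
-- first-group points 0, 1 are constructors whose distinctness is decided by (λ ()).
corollary5p2 f k m n λ₁ λ₂ (s≤s (s≤s (s≤s _))) 2≤m@(s≤s (s≤s _)) (s≤s (s≤s _)) (A , linked) λ₁≢λ₂ refl =
  map₂ (λ (0<l , v≡ , k≡ , m≡ , λ₂≡) → 0<l , v≡ , k≡ , m≡ , refl , λ₂≡)
    (squareParameters (λ λ₂≡0 → λ₁≢λ₂ (sym λ₂≡0)) 2≤m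
      {fzero} {fsuc fzero} (λ ()) (s≤s z≤n) (s≤s (s≤s z≤n)))
  where
  open LinkedTriple k m n λ₂ linked {fzero} {fsuc fzero} {fsuc (fsuc fzero)} (λ ()) (λ ()) (λ ())
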